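{- For $\rho,\sigma\in\mathbb{F}_3^4$, the points $p_\rho=A_\rho u$ and $p_\sigma=A_\sigma u$ of $\omega_4$ satisfy $B(p_\rho,p_\sigma)=0$ (are orthogonal) if $\operatorname{hd}_\varepsilon(\rho,\sigma)$ is even, and $B(p_\rho,p_\sigma)=1$ if $\operatorname{hd}_\varepsilon(\rho,\sigma)$ is odd.
   Context: Work over $\mathbb{F}_2$. $V_8=V(8,2)$ with basis $e_1,\dots,e_8$, $V_a=\langle e_1,e_8\rangle$, $V_b=\langle e_2,e_7\rangle$, $V_c=\langle e_3,e_6\rangle$, $V_d=\langle e_4,e_5\rangle$. $B$ is the alternating form $B(x,y)=(x_1y_8+x_8y_1)+(x_2y_7+x_7y_2)+(x_3y_6+x_6y_3)+(x_4y_5+x_5y_4)$. Let $\zeta_a: e_1\mapsto e_8\mapsto e_1+e_8\mapsto e_1$, $\zeta_b: e_7\mapsto e_2\mapsto e_2+e_7\mapsto e_7$, $\zeta_c: e_3\mapsto e_6\mapsto e_3+e_6\mapsto e_3$, $\zeta_d: e_5\mapsto e_4\mapsto e_4+e_5\mapsto e_5$; for $\lambda=ijkl\in\mathbb{F}_3^4$, $A_\lambda=\zeta_a^i\oplus\zeta_b^j\oplus\zeta_c^k\oplus\zeta_d^l$; $u=e_1+\dots+e_8$. $\omega_4=\{A_\lambda u\}$. $\operatorname{hd}_\varepsilon(\rho,\sigma)$ is the number of coordinates (in the standard basis of $\mathbb{F}_3^4$) in which $\rho$ and $\sigma$ differ. -}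

module Defs where

open import Data.Bool using (Bool; true; false; _xor_)
open import Data.Nat using (ℕ; zero; suc; _+_)
open import Data.Fin using (Fin; toℕ)
open import Data.Vec using (Vec; []; _∷_; lookup; zipWith; replicate; foldr)
open import Data.Product using (_×_; _,_)
open import Relation.Nullary using (Dec; yes; no)
open import Data.Fin using (_≟_)

-- 𝔽₂ is Bool with xor as addition and ∧ as multiplication.
-- A vector of V₈ = V(8,2): component at index i (0-based) is the
-- coefficient of e_(i+1).
V₈ : Set
V₈ = Vec Bool 8

F₃⁴ : Set
F₃⁴ = Vec (Fin 3) 4

-- a 2-dim block with ordered basis (f , g) on which ζ acts by
-- f ↦ g ↦ f + g ↦ f :  α f + β g ↦ β f + (α + β) g
ζ₂ : Bool × Bool → Bool × Bool
ζ₂ (α , β) = (β , α xor β)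

iter : {A : Set} → ℕ → (A → A) → A → A
iter zero f x = x
iter (suc n) f x = f (iter n f x)

-- A_λ = ζ_a^i ⊕ ζ_b^j ⊕ ζ_c^k ⊕ ζ_d^l, λ = ijkl
-- blocks (ordered basis (f,g)):  a: (e1,e8)  b: (e7,e2)  c: (e3,e6)  d: (e5,e4)
A : F₃⁴ → V₈ → V₈
A (i ∷ j ∷ k ∷ l ∷ []) (x1 ∷ x2 ∷ x3 ∷ x4 ∷ x5 ∷ x6 ∷ x7 ∷ x8 ∷ []) =
  let (y1 , y8) = iter (toℕ i) ζ₂ (x1 , x8)
      (y7 , y2) = iter (toℕ j) ζ₂ (x7 , x2)
      (y3 , y6) = iter (toℕ k) ζ₂ (x3 , x6)
      (y5 , y4) = iter (toℕ l) ζ₂ (x5 , x4)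
  in y1 ∷ y2 ∷ y3 ∷ y4 ∷ y5 ∷ y6 ∷ y7 ∷ y8 ∷ []

u : V₈
u = replicate 8 true

infixl 6 _⊕_
_⊕_ : Bool → Bool → Bool
_⊕_ = _xor_

_·_ : Bool → Bool → Bool
true · b = b
false · b = false

B : V₈ → V₈ → Bool
B (x1 ∷ x2 ∷ x3 ∷ x4 ∷ x5 ∷ x6 ∷ x7 ∷ x8 ∷ [])
  (y1 ∷ y2 ∷ y3 ∷ y4 ∷ y5 ∷ y6 ∷ y7 ∷ y8 ∷ []) =
  ((x1 · y8) ⊕ (x8 · y1)) ⊕ ((x2 · y7) ⊕ (x7 · y2))
  ⊕ ((x3 · y6) ⊕ (x6 · y3)) ⊕ ((x4 · y5) ⊕ (x5 · y4))

hd : {n : ℕ} → Vec (Fin 3) n → Vec (Fin 3) n → ℕ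
hd [] [] = 0
hd (a ∷ as) (b ∷ bs) with a ≟ b
... | yes _ = hd as bs
... | no _ = suc (hd as bs)

p : F₃⁴ → V₈
p λ' = A λ' u

-- Each block of V₈ is a hyperbolic plane on which B restricts to the form
-- ω((α,β),(α',β')) = αβ' + βα', and u has component (1,1) in every block.
-- The ζ-orbit of (1,1) is {(1,1),(1,0),(0,1)}, the three nonzero vectors of
-- 𝔽₂², and ω of two nonzero vectors is 1 exactly when they differ. Since A_λ
-- acts blockwise, B(p_ρ,p_σ) is the sum over the four blocks of [ρᵢ ≠ σᵢ],
-- i.e. the parity of hd(ρ,σ).
module Submission where

open import Defs
open import Data.Bool using (Bool; true; false; not)
open import Data.Bool.Properties using (xor-assoc; xor-comm; xor-identityʳ)
open import Data.Fin using (Fin; zero; suc; toℕ; _≟_)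
open import Data.Nat using (ℕ; _%_)
open import Data.Product using (_×_; _,_; proj₁; proj₂)
open import Data.Vec using (Vec; []; _∷_; foldr′; zipWith)
open import Relation.Nullary using (yes; no)
open import Relation.Nullary.Decidable using (⌊_⌋)
open import Relation.Binary.PropositionalEquality
  using (_≡_; refl; sym; trans; cong; cong₂; module ≡-Reasoning)

isOdd : ℕ → Bool
isOdd 0 = false
isOdd 1 = true
isOdd (ℕ.suc (ℕ.suc n)) = isOdd n

isOdd-%2 : ∀ n → isOdd n ≡ isOdd (n % 2)
isOdd-%2 0 = refl
isOdd-%2 1 = refl
isOdd-%2 (ℕ.suc (ℕ.suc n)) = isOdd-%2 n

differ : {n : ℕ} → Fin n → Fin n → Bool
differ a b = not ⌊ a ≟ b ⌋

isOdd-hd : ∀ {n} (ρ σ : Vec (Fin 3) n) →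
           isOdd (hd ρ σ) ≡ foldr′ _⊕_ false (zipWith differ ρ σ)
isOdd-hd [] [] = refl
isOdd-hd (a ∷ ρ) (b ∷ σ) with a ≟ b
... | yes _ = isOdd-hd ρ σ
... | no _ = trans (isOdd-suc (hd ρ σ)) (cong not (isOdd-hd ρ σ))
  where
  isOdd-suc : ∀ n → isOdd (ℕ.suc n) ≡ not (isOdd n)
  isOdd-suc 0 = refl
  isOdd-suc 1 = refl
  isOdd-suc (ℕ.suc (ℕ.suc n)) = isOdd-suc n

hyperbolic : Bool × Bool → Bool × Bool → Bool
hyperbolic (α , β) (α' , β') = (α · β') ⊕ (β · α')

-- Each pair is a block in the ordered basis (f , g) used by A, so blocks b and d
-- are read off in the order (e₇ , e₂) and (e₅ , e₄).
blocks : (a b c d : Bool × Bool) → V₈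
blocks a b c d =
  proj₁ a ∷ proj₂ b ∷ proj₁ c ∷ proj₂ d ∷ proj₁ d ∷ proj₂ c ∷ proj₁ b ∷ proj₂ a ∷ []

B-blocks : ∀ a b c d a' b' c' d' →
  B (blocks a b c d) (blocks a' b' c' d')
    ≡ hyperbolic a a' ⊕ hyperbolic b b' ⊕ hyperbolic c c' ⊕ hyperbolic d d'
B-blocks a b c d a' b' c' d' =
  cong₂ (λ x y → hyperbolic a a' ⊕ x ⊕ hyperbolic c c' ⊕ y)
        (xor-comm (proj₂ b · proj₁ b') (proj₁ b · proj₂ b'))
        (xor-comm (proj₂ d · proj₁ d') (proj₁ d · proj₂ d'))

orbit : Fin 3 → Bool × Bool
orbit i = iter (toℕ i) ζ₂ (true , true)

p-blocks : ∀ i j k l → p (i ∷ j ∷ k ∷ l ∷ []) ≡ blocks (orbit i) (orbit j) (orbit k) (orbit l)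
p-blocks i j k l = refl

hyperbolic-orbit : ∀ i j → hyperbolic (orbit i) (orbit j) ≡ differ i j
hyperbolic-orbit zero zero = refl
hyperbolic-orbit zero (suc zero) = refl
hyperbolic-orbit zero (suc (suc zero)) = refl
hyperbolic-orbit (suc zero) zero = refl
hyperbolic-orbit (suc zero) (suc zero) = refl
hyperbolic-orbit (suc zero) (suc (suc zero)) = refl
hyperbolic-orbit (suc (suc zero)) zero = refl
hyperbolic-orbit (suc (suc zero)) (suc zero) = refl
hyperbolic-orbit (suc (suc zero)) (suc (suc zero)) = refl

B-p≡isOdd-hd : (ρ σ : F₃⁴) → B (p ρ) (p σ) ≡ isOdd (hd ρ σ)
B-p≡isOdd-hd (i ∷ j ∷ k ∷ l ∷ []) (i' ∷ j' ∷ k' ∷ l' ∷ []) = begin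
  B (p (i ∷ j ∷ k ∷ l ∷ [])) (p (i' ∷ j' ∷ k' ∷ l' ∷ []))
    ≡⟨ cong₂ B (p-blocks i j k l) (p-blocks i' j' k' l') ⟩
  B (blocks (orbit i) (orbit j) (orbit k) (orbit l))
    (blocks (orbit i') (orbit j') (orbit k') (orbit l'))
    ≡⟨ B-blocks (orbit i) (orbit j) (orbit k) (orbit l)
                (orbit i') (orbit j') (orbit k') (orbit l') ⟩
  hyperbolic (orbit i) (orbit i') ⊕ hyperbolic (orbit j) (orbit j')
    ⊕ hyperbolic (orbit k) (orbit k') ⊕ hyperbolic (orbit l) (orbit l')
    ≡⟨ cong₂ _⊕_ (cong₂ _⊕_ (cong₂ _⊕_ (hyperbolic-orbit i i') (hyperbolic-orbit j j'))
                            (hyperbolic-orbit k k'))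
                 (hyperbolic-orbit l l') ⟩
  differ i i' ⊕ differ j j' ⊕ differ k k' ⊕ differ l l'
    ≡⟨ reassociate (differ i i') (differ j j') (differ k k') (differ l l') ⟩
  differ i i' ⊕ (differ j j' ⊕ (differ k k' ⊕ (differ l l' ⊕ false)))
    ≡⟨ sym (isOdd-hd (i ∷ j ∷ k ∷ l ∷ []) (i' ∷ j' ∷ k' ∷ l' ∷ [])) ⟩
  isOdd (hd (i ∷ j ∷ k ∷ l ∷ []) (i' ∷ j' ∷ k' ∷ l' ∷ [])) ∎
  where
  open ≡-Reasoning
  reassociate : ∀ w x y z → w ⊕ x ⊕ y ⊕ z ≡ w ⊕ (x ⊕ (y ⊕ (z ⊕ false)))
  reassociate w x y z = trans (xor-assoc (w ⊕ x) y z)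
    (trans (xor-assoc w x (y ⊕ z))
      (cong (λ t → w ⊕ (x ⊕ (y ⊕ t))) (sym (xor-identityʳ z))))

lemma4 : (ρ σ : F₃⁴) →
    ((hd ρ σ % 2 ≡ 0 → B (p ρ) (p σ) ≡ false) × (hd ρ σ % 2 ≡ 1 → B (p ρ) (p σ) ≡ true))
lemma4 ρ σ = B-isOdd-%2 , B-isOdd-%2
  where
  B-isOdd-%2 : ∀ {r} → hd ρ σ % 2 ≡ r → B (p ρ) (p σ) ≡ isOdd r
  B-isOdd-%2 e = trans (B-p≡isOdd-hd ρ σ) (trans (isOdd-%2 (hd ρ σ)) (cong isOdd e))
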